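{- Let $w$ be a word in the alphabet $\{1,\dots,q\}$ and let $1\le a,b<q$. If $$\ell(W(w))>\sum_{i=1}^{a}\min(b,q-i+1)\quad\Big(\text{equivalently } \ell(W(w))>\sum_{j=1}^{b}\min(a,q-j+1)\Big),$$ then $\mathtt{LIS}(w)>a$ or $\mathtt{LDS}(w)>b$.
   Context: The 0-Hecke monoid is the quotient of the free monoid on $\{1,\dots,q\}$ by the relations $i\,i\equiv i$, $i\,j\,i\equiv j\,i\,j$, and $i\,j\equiv j\,i$ for $|i-j|\ge2$. Identifying the letter $i$ with the simple transposition $s_i=(i\ i+1)\in S_{q+1}$, every word $w$ is equivalent to a reduced word of a unique permutation $W(w)\in S_{q+1}$. $\ell(\pi)$ denotes the Coxeter length (number of inversions) of $\pi$. $\mathtt{LIS}(w)$ (resp. $\mathtt{LDS}(w)$) is the length of the longest strictly increasing (resp. strictly decreasing) subsequence of $w$. -}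

module Defs where

open import Data.Nat using (ℕ; zero; suc; _+_; _∸_; _<_; _≤_; _⊓_)
open import Data.Fin using (Fin; toℕ; fromℕ<; inject₁) renaming (suc to fsuc; zero to fzero)
import Data.Fin as F
open import Data.List using (List; []; _∷_; _++_; length; foldl)
open import Data.Vec using (Vec; allFin; lookup; _[_]≔_)
open import Data.List.Relation.Binary.Sublist.Propositional using (_⊆_)
open import Data.List.Relation.Unary.Linked using (Linked)
open import Data.Product using (∃; _×_)
open import Relation.Nullary using (yes; no)

-- A word in the alphabet {1,…,q}: the letter (k : Fin q) stands for k+1,
-- i.e. for the simple transposition s_{k+1} swapping positions k, k+1
-- (0-based) of {0,…,q} ≅ {1,…,q+1}.
Word : ℕ → Set
Word q = List (Fin q)

dist : ∀ {q} → Fin q → Fin q → ℕ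
dist i j = (toℕ i ∸ toℕ j) + (toℕ j ∸ toℕ i)

data HeckeRel {q : ℕ} : Word q → Word q → Set where
  idem  : ∀ i → HeckeRel (i ∷ i ∷ []) (i ∷ [])
  braid : ∀ i j → HeckeRel (i ∷ j ∷ i ∷ []) (j ∷ i ∷ j ∷ [])
  comm  : ∀ i j → 2 ≤ dist i j → HeckeRel (i ∷ j ∷ []) (j ∷ i ∷ [])

data _≈H_ {q : ℕ} : Word q → Word q → Set where
  step  : ∀ u v l r → HeckeRel l r → (u ++ l ++ v) ≈H (u ++ r ++ v)
  ≈refl : ∀ {u} → u ≈H u
  ≈sym  : ∀ {u v} → u ≈H v → v ≈H u
  ≈trans : ∀ {u v x} → u ≈H v → v ≈H x → u ≈H x

-- Permutations of {0,…,q} in one-line notation.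
Perm : ℕ → Set
Perm q = Vec (Fin (suc q)) (suc q)

-- right multiplication by the simple transposition s_{k+1}: swap entries k, k+1
swapAt : ∀ {q} → Perm q → Fin q → Perm q
swapAt π k = (π [ inject₁ k ]≔ lookup π (fsuc k)) [ fsuc k ]≔ lookup π (inject₁ k)

-- the permutation s_{i1} s_{i2} ⋯ s_{ik} of a word i1 i2 … ik (as a product in S_{q+1})
permOf : ∀ {q} → Word q → Perm q
permOf {q} w = foldl swapAt (allFin (suc q)) w

-- Coxeter length = number of inversions: pairs i < j with π(i) > π(j)
countInv : ∀ {q n} → Perm q → Fin (suc q) → Vec (Fin (suc q)) n → ℕ
countInv π i Data.Vec.[] = 0
countInv π i (j Data.Vec.∷ js) with toℕ i Data.Nat.<? toℕ j | toℕ (lookup π j) Data.Nat.<? toℕ (lookup π i)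
... | yes _ | yes _ = suc (countInv π i js)
... | _     | _     = countInv π i js

invs : ∀ {q n} → Perm q → Vec (Fin (suc q)) n → ℕ
invs π Data.Vec.[] = 0
invs {q} π (i Data.Vec.∷ is) = countInv π i (allFin (suc q)) + invs π is

ℓ : ∀ {q} → Perm q → ℕ
ℓ {q} π = invs π (allFin (suc q))

IsReducedWordOf : ∀ {q} → Word q → Perm q → Set
IsReducedWordOf u π = (permOf u ≡' π) × (length u ≡' ℓ π)
  where open import Relation.Binary.PropositionalEquality renaming (_≡_ to _≡'_)

-- W(w) = π : w is equivalent in the 0-Hecke monoid to a reduced word of π
IsW : ∀ {q} → Word q → Perm q → Set
IsW w π = ∃ λ u → (w ≈H u) × IsReducedWordOf u π

_<L_ : ∀ {q} → Fin q → Fin q → Set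
i <L j = toℕ i < toℕ j

_>L_ : ∀ {q} → Fin q → Fin q → Set
i >L j = toℕ j < toℕ i

LIS> : ∀ {q} → Word q → ℕ → Set
LIS> w a = ∃ λ s → (s ⊆ w) × Linked _<L_ s × a < length s

LDS> : ∀ {q} → Word q → ℕ → Set
LDS> w b = ∃ λ s → (s ⊆ w) × Linked _>L_ s × b < length s

bound : ℕ → ℕ → ℕ → ℕ
bound q zero b = 0
bound q (suc a) b = bound q a b + (b ⊓ (q ∸ suc a + 1))

module Submission where

-- The 0-Hecke monoid acts on functions g : {0,…,q} → ℕ, the letter k sorting
-- the values at positions k, k+1 into decreasing order.  The action respects
-- the defining relations (checked on windows of two and three values), so
-- equivalent words act alike.  Each letter adds at most one inversion, and
-- along a reduced word every letter adds one, so there sorting is the same as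
-- multiplying by simple transpositions: ℓ(W(w)) is the inversion number of
-- the identity sorted by w.  Hecke row insertion then rewrites w as an
-- equivalent word w′ R, with R an increasing row of length ≤ min(a, q - lo)
-- (lo bounding the letters of w from below), the letters of w′ above lo, no
-- increasing subsequence of w′ longer than R, and every decreasing one lifting
-- to a longer one of w.  Peeling off b rows bounds the inversions by a
-- staircase Σ_{t<b} min(a, q - t), which counted by columns is the bound above.

open import Defs
open import Level using (0ℓ)
open import Data.Nat using (ℕ; zero; suc; _+_; _*_; _∸_; _<_; _≤_; _⊓_; _⊔_; z≤n; s≤s; _<?_)
open import Data.Nat.Properties
open import Data.Fin using (Fin; toℕ; inject₁) renaming (suc to fsuc; zero to fzero)
open import Data.Fin.Properties using (toℕ-injective; toℕ-inject₁; toℕ<n) renaming (_≟_ to _≟F_)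
open import Data.List using (List; []; _∷_; _++_; [_]; length; foldl)
open import Data.List.Properties using (foldl-++; length-++; ++-assoc; ++-identityʳ)
open import Data.List.Membership.Propositional using (_∈_)
open import Data.List.Membership.Propositional.Properties using (∈-++⁺ˡ; ∈-++⁺ʳ; ∈-++⁻)
open import Data.List.Relation.Unary.Any using (here; there)
open import Data.List.Relation.Unary.All as All using (All; []; _∷_)
open import Data.List.Relation.Unary.All.Properties using (∷ʳ⁺; ∷ʳ⁻)
open import Data.List.Relation.Binary.Sublist.Propositional using (_⊆_; []; _∷_; _∷ʳ_; ⊆-trans; ⊆-refl; from∈; minimum)
open import Data.List.Relation.Binary.Sublist.Propositional.Properties using (++⁺; ++⁺ʳ)
open import Data.List.Relation.Unary.Linked as Linked using (Linked; []; [-]; _∷_)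
open import Data.List.Relation.Unary.Linked.Properties using (Linked⇒All)
open import Data.Vec using (lookup; tabulate; allFin; _[_]≔_)
open import Data.Vec.Properties using (lookup∘update; lookup∘update′; lookup-allFin)
open import Data.Sum using (_⊎_; inj₁; inj₂; [_,_]′)
open import Data.Product using (_×_; _,_; proj₁; proj₂; ∃)
open import Function using (_∘_)
open import Relation.Binary.Core using (Rel)
open import Relation.Binary.Definitions using (Transitive; Tri; tri<; tri≈; tri>)
open import Relation.Nullary using (Dec; yes; no; ¬_; contradiction)
open import Relation.Binary.PropositionalEquality hiding ([_])
open import Algebra.Properties.CommutativeMonoid.Sum +-0-commutativeMonoid
  using (sum; sum-cong-≗; ∑-distrib-+; sum-replicate-zero)
open import Algebra.Properties.CommutativeSemigroup +-commutativeSemigroup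
  using (x∙yz≈y∙xz; x∙yz≈yx∙z)

swapIx : ∀ {q} → Fin q → Fin (suc q) → Fin (suc q)
swapIx fzero fzero = fsuc fzero
swapIx fzero (fsuc fzero) = fzero
swapIx fzero (fsuc (fsuc x)) = fsuc (fsuc x)
swapIx (fsuc k) fzero = fzero
swapIx (fsuc k) (fsuc x) = fsuc (swapIx k x)

swapIx-involutive : ∀ {q} (k : Fin q) x → swapIx k (swapIx k x) ≡ x
swapIx-involutive fzero fzero = refl
swapIx-involutive fzero (fsuc fzero) = refl
swapIx-involutive fzero (fsuc (fsuc x)) = refl
swapIx-involutive (fsuc k) fzero = refl
swapIx-involutive (fsuc k) (fsuc x) = cong fsuc (swapIx-involutive k x)

swapIx-left : ∀ {q} (k : Fin q) → swapIx k (inject₁ k) ≡ fsuc k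
swapIx-left fzero = refl
swapIx-left (fsuc k) = cong fsuc (swapIx-left k)

swapIx-right : ∀ {q} (k : Fin q) → swapIx k (fsuc k) ≡ inject₁ k
swapIx-right fzero = refl
swapIx-right (fsuc k) = cong fsuc (swapIx-right k)

swapIx-away : ∀ {q} (k : Fin q) x → x ≢ inject₁ k → x ≢ fsuc k → swapIx k x ≡ x
swapIx-away fzero fzero ≢l ≢r = contradiction refl ≢l
swapIx-away fzero (fsuc fzero) ≢l ≢r = contradiction refl ≢r
swapIx-away fzero (fsuc (fsuc x)) ≢l ≢r = refl
swapIx-away (fsuc k) fzero ≢l ≢r = refl
swapIx-away (fsuc k) (fsuc x) ≢l ≢r =
  cong fsuc (swapIx-away k x (≢l ∘ cong fsuc) (≢r ∘ cong fsuc))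

swapIx-reflects-< : ∀ {q} (k : Fin q) x y → toℕ (swapIx k x) < toℕ (swapIx k y) →
                    toℕ x < toℕ y ⊎ (x ≡ fsuc k × y ≡ inject₁ k)
swapIx-reflects-< fzero fzero fzero (s≤s ())
swapIx-reflects-< fzero fzero (fsuc fzero) ()
swapIx-reflects-< fzero fzero (fsuc (fsuc y)) _ = inj₁ (s≤s z≤n)
swapIx-reflects-< fzero (fsuc fzero) fzero _ = inj₂ (refl , refl)
swapIx-reflects-< fzero (fsuc fzero) (fsuc fzero) ()
swapIx-reflects-< fzero (fsuc fzero) (fsuc (fsuc y)) _ = inj₁ (s≤s (s≤s z≤n))
swapIx-reflects-< fzero (fsuc (fsuc x)) fzero (s≤s ())
swapIx-reflects-< fzero (fsuc (fsuc x)) (fsuc fzero) ()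
swapIx-reflects-< fzero (fsuc (fsuc x)) (fsuc (fsuc y)) x<y = inj₁ x<y
swapIx-reflects-< (fsuc k) fzero fzero ()
swapIx-reflects-< (fsuc k) fzero (fsuc y) _ = inj₁ (s≤s z≤n)
swapIx-reflects-< (fsuc k) (fsuc x) fzero ()
swapIx-reflects-< (fsuc k) (fsuc x) (fsuc y) (s≤s x<y) with swapIx-reflects-< k x y x<y
... | inj₁ x<y′ = inj₁ (s≤s x<y′)
... | inj₂ (refl , refl) = inj₂ (refl , refl)

data Position {q} (k : Fin q) : Fin (suc q) → Set where
  left  : Position k (inject₁ k)
  right : Position k (fsuc k)
  away  : ∀ {x} → x ≢ inject₁ k → x ≢ fsuc k → Position k x

position : ∀ {q} (k : Fin q) x → Position k x
position k x with x ≟F inject₁ k | x ≟F fsuc k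
... | yes refl | _ = left
... | no _ | yes refl = right
... | no ≢l | no ≢r = away ≢l ≢r

sum-swapIx : ∀ {q} (k : Fin q) (f : Fin (suc q) → ℕ) → sum (f ∘ swapIx k) ≡ sum f
sum-swapIx fzero f = x∙yz≈y∙xz (f (fsuc fzero)) (f fzero) _
sum-swapIx (fsuc k) f = cong (f fzero +_) (sum-swapIx k (f ∘ fsuc))

sum-mono : ∀ {n} {f g : Fin n → ℕ} → (∀ i → f i ≤ g i) → sum f ≤ sum g
sum-mono {zero} f≤g = z≤n
sum-mono {suc n} f≤g = +-mono-≤ (f≤g fzero) (sum-mono (f≤g ∘ fsuc))

point : ∀ {n} → Fin n → ℕ → Fin n → ℕ
point fzero c fzero = c
point fzero c (fsuc _) = 0
point (fsuc p) c fzero = 0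
point (fsuc p) c (fsuc i) = point p c i

point-at : ∀ {n} (p : Fin n) c → point p c p ≡ c
point-at fzero c = refl
point-at (fsuc p) c = point-at p c

sum-point : ∀ {n} (p : Fin n) c → sum (point p c) ≡ c
sum-point {suc n} fzero c = trans (cong (c +_) (sum-replicate-zero n)) (+-identityʳ c)
sum-point (fsuc p) c = sum-point p c

sum-point-inside : ∀ {m n} (p i : Fin n) (h : Fin m → ℕ) → sum (λ j → point p (h j) i) ≡ point p (sum h) i
sum-point-inside fzero fzero h = refl
sum-point-inside {m} fzero (fsuc i) h = sum-replicate-zero m
sum-point-inside {m} (fsuc p) fzero h = sum-replicate-zero m
sum-point-inside (fsuc p) (fsuc i) h = sum-point-inside p i h

point² : ∀ {n} → Fin n → Fin n → ℕ → Fin n → Fin n → ℕ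
point² p p′ c i j = point p (point p′ c j) i

sum-point² : ∀ {n} (p p′ : Fin n) c → sum (λ i → sum (point² p p′ c i)) ≡ c
sum-point² p p′ c = begin
  sum (λ i → sum (λ j → point p (point p′ c j) i))  ≡⟨ sum-cong-≗ (λ i → sum-point-inside p i (point p′ c)) ⟩
  sum (point p (sum (point p′ c)))                  ≡⟨ cong (sum ∘ point p) (sum-point p′ c) ⟩
  sum (point p c)                                   ≡⟨ sum-point p c ⟩
  c                                                 ∎
  where open ≡-Reasoning

𝟙 : ∀ {P : Set} → Dec P → ℕ
𝟙 (yes _) = 1
𝟙 (no _) = 0

𝟙-yes : ∀ {P : Set} (d : Dec P) → P → 𝟙 d ≡ 1
𝟙-yes (yes _) _ = refl
𝟙-yes (no ¬p) p = contradiction p ¬p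

𝟙-no : ∀ {P : Set} (d : Dec P) → ¬ P → 𝟙 d ≡ 0
𝟙-no (yes p) ¬p = contradiction p ¬p
𝟙-no (no _) _ = refl

𝟙≤1 : ∀ {P : Set} (d : Dec P) → 𝟙 d ≤ 1
𝟙≤1 (yes _) = s≤s z≤n
𝟙≤1 (no _) = z≤n

𝟙-mono : ∀ {P Q : Set} → (P → Q) → (d : Dec P) (e : Dec Q) → 𝟙 d ≤ 𝟙 e
𝟙-mono P⇒Q (yes p) e = ≤-reflexive (sym (𝟙-yes e (P⇒Q p)))
𝟙-mono P⇒Q (no _) e = z≤n

-- A function on the positions {0,…,q} with values in ℕ; a permutation is
-- seen as the function i ↦ π(i).
Values : ℕ → Set
Values q = Fin (suc q) → ℕ

inverted : ∀ {q} → Values q → Fin (suc q) → Fin (suc q) → ℕ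
inverted g i j = 𝟙 (toℕ i <? toℕ j) * 𝟙 (g j <? g i)

inversions : ∀ {q} → Values q → ℕ
inversions g = sum λ i → sum λ j → inverted g i j

inversions-cong : ∀ {q} {g h : Values q} → g ≗ h → inversions g ≡ inversions h
inversions-cong g≗h = sum-cong-≗ λ i → sum-cong-≗ λ j →
  cong₂ (λ x y → 𝟙 (toℕ i <? toℕ j) * 𝟙 (x <? y)) (g≗h j) (g≗h i)

inversions-id : ∀ {q} → inversions {q} toℕ ≡ 0
inversions-id {q} = trans (sum-cong-≗ λ i → trans (sum-cong-≗ (none i)) (sum-replicate-zero (suc q)))
                          (sum-replicate-zero (suc q))
  where
  none : ∀ (i j : Fin (suc q)) → inverted toℕ i j ≡ 0
  none i j with toℕ i <? toℕ j
  ... | yes i<j = cong (1 *_) (𝟙-no (toℕ j <? toℕ i) (<-asym i<j))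
  ... | no _ = refl

inverted-swap : ∀ {q} (g : Values q) (k : Fin q) a b →
  inverted (g ∘ swapIx k) (swapIx k a) (swapIx k b) ≤
  inverted g a b + point² (fsuc k) (inject₁ k) (𝟙 (g (inject₁ k) <? g (fsuc k))) a b
inverted-swap g k a b rewrite swapIx-involutive k a | swapIx-involutive k b
  with toℕ (swapIx k a) <? toℕ (swapIx k b) | g b <? g a
... | no _ | _ = z≤n
... | yes _ | no _ = z≤n
... | yes τa<τb | yes gb<ga with swapIx-reflects-< k a b τa<τb
...   | inj₁ a<b rewrite 𝟙-yes (toℕ a <? toℕ b) a<b = s≤s z≤n
...   | inj₂ (refl , refl) rewrite point-at (inject₁ k) (𝟙 (g (inject₁ k) <? g (fsuc k)))
                                 | point-at (fsuc k) (𝟙 (g (inject₁ k) <? g (fsuc k)))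
                                 | 𝟙-yes (g (inject₁ k) <? g (fsuc k)) gb<ga = m≤n+m 1 _

inversions-swap : ∀ {q} (g : Values q) (k : Fin q) →
  inversions (g ∘ swapIx k) ≤ inversions g + 𝟙 (g (inject₁ k) <? g (fsuc k))
inversions-swap {q} g k = begin
    inversions (g ∘ swapIx k)
  ≡⟨ sum-swapIx k (λ i → sum (inverted (g ∘ swapIx k) i)) ⟨
    sum (λ i → sum λ j → inverted (g ∘ swapIx k) (swapIx k i) j)
  ≡⟨ sum-cong-≗ (λ i → sum-swapIx k (inverted (g ∘ swapIx k) (swapIx k i))) ⟨
    sum (λ i → sum λ j → inverted (g ∘ swapIx k) (swapIx k i) (swapIx k j))
  ≤⟨ sum-mono (λ i → sum-mono (λ j → inverted-swap g k i j)) ⟩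
    sum (λ i → sum λ j → inverted g i j + new i j)
  ≡⟨ sum-cong-≗ (λ i → ∑-distrib-+ (inverted g i) (new i)) ⟩
    sum (λ i → sum (inverted g i) + sum (new i))
  ≡⟨ ∑-distrib-+ (λ i → sum (inverted g i)) (λ i → sum (new i)) ⟩
    inversions g + sum (λ i → sum (new i))
  ≡⟨ cong (inversions g +_) (sum-point² (fsuc k) (inject₁ k) c) ⟩
    inversions g + c ∎
  where
  open ≤-Reasoning
  c : ℕ
  c = 𝟙 (g (inject₁ k) <? g (fsuc k))
  new : Fin (suc q) → Fin (suc q) → ℕ
  new = point² (fsuc k) (inject₁ k) c

-- One generator of the 0-Hecke monoid acting on value functions: put the
-- larger of the values at positions k, k+1 first.
sortStepBy : ∀ {q} {P : Set} → Dec P → Values q → Fin q → Values q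
sortStepBy (yes _) g k = g ∘ swapIx k
sortStepBy (no _) g k = g

sortStep : ∀ {q} → Values q → Fin q → Values q
sortStep g k = sortStepBy (g (inject₁ k) <? g (fsuc k)) g k

sortStep-cases : ∀ {q} (g : Values q) k →
  (g (inject₁ k) < g (fsuc k) × sortStep g k ≡ g ∘ swapIx k) ⊎
  (¬ g (inject₁ k) < g (fsuc k) × sortStep g k ≡ g)
sortStep-cases g k with g (inject₁ k) <? g (fsuc k)
... | yes asc = inj₁ (asc , refl)
... | no ¬asc = inj₂ (¬asc , refl)

sortStep-left : ∀ {q} (g : Values q) k → sortStep g k (inject₁ k) ≡ g (inject₁ k) ⊔ g (fsuc k)
sortStep-left g k with sortStep-cases g k
... | inj₁ (asc , eq) rewrite eq = trans (cong g (swapIx-left k)) (sym (m≤n⇒m⊔n≡n (<⇒≤ asc)))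
... | inj₂ (¬asc , eq) rewrite eq = sym (m≥n⇒m⊔n≡m (≮⇒≥ ¬asc))

sortStep-right : ∀ {q} (g : Values q) k → sortStep g k (fsuc k) ≡ g (inject₁ k) ⊓ g (fsuc k)
sortStep-right g k with sortStep-cases g k
... | inj₁ (asc , eq) rewrite eq = trans (cong g (swapIx-right k)) (sym (m≤n⇒m⊓n≡m (<⇒≤ asc)))
... | inj₂ (¬asc , eq) rewrite eq = sym (m≥n⇒m⊓n≡n (≮⇒≥ ¬asc))

sortStep-away : ∀ {q} (g : Values q) k {x} → x ≢ inject₁ k → x ≢ fsuc k → sortStep g k x ≡ g x
sortStep-away g k ≢l ≢r with sortStep-cases g k
... | inj₁ (_ , eq) rewrite eq = cong g (swapIx-away k _ ≢l ≢r)
... | inj₂ (_ , eq) rewrite eq = refl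

sortStep-cong : ∀ {q} {g h : Values q} → g ≗ h → ∀ k → sortStep g k ≗ sortStep h k
sortStep-cong {g = g} {h} g≗h k x with position k x
... | left = trans (sortStep-left g k) (trans (cong₂ _⊔_ (g≗h _) (g≗h _)) (sym (sortStep-left h k)))
... | right = trans (sortStep-right g k) (trans (cong₂ _⊓_ (g≗h _) (g≗h _)) (sym (sortStep-right h k)))
... | away ≢l ≢r = trans (sortStep-away g k ≢l ≢r) (trans (g≗h x) (sym (sortStep-away h k ≢l ≢r)))

sortBy : ∀ {q} → Values q → Word q → Values q
sortBy = foldl sortStep

sortBy-cong : ∀ {q} {g h : Values q} → g ≗ h → ∀ u → sortBy g u ≗ sortBy h u
sortBy-cong g≗h [] = g≗h
sortBy-cong g≗h (k ∷ u) = sortBy-cong (sortStep-cong g≗h k) u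

sortBy-++ : ∀ {q} (g : Values q) u v → sortBy g (u ++ v) ≗ sortBy (sortBy g u) v
sortBy-++ g u v x = cong (λ f → f x) (foldl-++ sortStep g u v)

record _∼_ {q} (u v : Word q) : Set where
  constructor act-eq
  field act : ∀ g → sortBy g u ≗ sortBy g v
open _∼_

∼-refl : ∀ {q} {u : Word q} → u ∼ u
∼-refl = act-eq λ g x → refl

∼-reflexive : ∀ {q} {u v : Word q} → u ≡ v → u ∼ v
∼-reflexive refl = ∼-refl

∼-sym : ∀ {q} {u v : Word q} → u ∼ v → v ∼ u
∼-sym u∼v = act-eq λ g x → sym (act u∼v g x)

∼-trans : ∀ {q} {u v w : Word q} → u ∼ v → v ∼ w → u ∼ w
∼-trans u∼v v∼w = act-eq λ g x → trans (act u∼v g x) (act v∼w g x)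

∼-prefix : ∀ {q} (p : Word q) {u v} → u ∼ v → (p ++ u) ∼ (p ++ v)
∼-prefix p {u} {v} u∼v = act-eq λ g x →
  trans (sortBy-++ g p u x) (trans (act u∼v (sortBy g p) x) (sym (sortBy-++ g p v x)))

∼-suffix : ∀ {q} (s : Word q) {u v} → u ∼ v → (u ++ s) ∼ (v ++ s)
∼-suffix s {u} {v} u∼v = act-eq λ g x →
  trans (sortBy-++ g u s x) (trans (sortBy-cong (act u∼v g) s x) (sym (sortBy-++ g v s x)))

sortPair : ℕ × ℕ → ℕ × ℕ
sortPair (a , b) = a ⊔ b , a ⊓ b

sortPair-idem : ∀ t → sortPair (sortPair t) ≡ sortPair t
sortPair-idem (a , b) = cong₂ _,_ (m≥n⇒m⊔n≡m (m⊓n≤m⊔n a b)) (m≥n⇒m⊓n≡n (m⊓n≤m⊔n a b))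

pair : ∀ {q} → Fin q → Values q → ℕ × ℕ
pair k h = h (inject₁ k) , h (fsuc k)

pair-sortStep : ∀ {q} (h : Values q) k → pair k (sortStep h k) ≡ sortPair (pair k h)
pair-sortStep h k = cong₂ _,_ (sortStep-left h k) (sortStep-right h k)

-- i i ∼ i: sorting a window twice is sorting it once.
∼-idem : ∀ {q} (i : Fin q) → (i ∷ i ∷ []) ∼ (i ∷ [])
∼-idem i = act-eq twice
  where
  pair-twice : ∀ g → pair i (sortStep (sortStep g i) i) ≡ pair i (sortStep g i)
  pair-twice g = begin
    pair i (sortStep (sortStep g i) i)  ≡⟨ pair-sortStep (sortStep g i) i ⟩
    sortPair (pair i (sortStep g i))    ≡⟨ cong sortPair (pair-sortStep g i) ⟩
    sortPair (sortPair (pair i g))      ≡⟨ sortPair-idem (pair i g) ⟩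
    sortPair (pair i g)                 ≡⟨ pair-sortStep g i ⟨
    pair i (sortStep g i)               ∎
    where open ≡-Reasoning
  twice : ∀ g x → sortStep (sortStep g i) i x ≡ sortStep g i x
  twice g x with position i x
  ... | left = cong proj₁ (pair-twice g)
  ... | right = cong proj₂ (pair-twice g)
  ... | away ≢l ≢r = sortStep-away (sortStep g i) i ≢l ≢r

record Apart {q} (i j : Fin q) : Set where
  field
    ll : inject₁ i ≢ inject₁ j
    lr : inject₁ i ≢ fsuc j
    rl : fsuc i ≢ inject₁ j
    rr : fsuc i ≢ fsuc j

apart-sym : ∀ {q} {i j : Fin q} → Apart i j → Apart j i
apart-sym a = record { ll = ≢-sym (Apart.ll a) ; lr = ≢-sym (Apart.rl a) ; rl = ≢-sym (Apart.lr a) ; rr = ≢-sym (Apart.rr a) }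

far-apart : ∀ a b → 2 ≤ (a ∸ b) + (b ∸ a) → a ≢ b × suc a ≢ b × a ≢ suc b
far-apart zero zero ()
far-apart zero (suc zero) (s≤s ())
far-apart zero (suc (suc b)) _ = (λ ()) , (λ ()) , (λ ())
far-apart (suc zero) zero (s≤s ())
far-apart (suc (suc a)) zero _ = (λ ()) , (λ ()) , (λ ())
far-apart (suc a) (suc b) d with far-apart a b d
... | ≢₁ , ≢₂ , ≢₃ = ≢₁ ∘ suc-injective , ≢₂ ∘ suc-injective , ≢₃ ∘ suc-injective

far⇒apart : ∀ {q} (i j : Fin q) → 2 ≤ dist i j → Apart i j
far⇒apart i j far with far-apart (toℕ i) (toℕ j) far
... | i≢j , 1+i≢j , i≢1+j = record
  { ll = λ e → i≢j (trans (sym (toℕ-inject₁ i)) (trans (cong toℕ e) (toℕ-inject₁ j)))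
  ; lr = λ e → i≢1+j (trans (sym (toℕ-inject₁ i)) (cong toℕ e))
  ; rl = λ e → 1+i≢j (trans (cong toℕ e) (toℕ-inject₁ j))
  ; rr = λ e → i≢j (suc-injective (cong toℕ e)) }

-- Sorting steps on disjoint windows commute; it suffices to compare the
-- results inside the first window, as outside both windows nothing moves.
module _ {q} {i j : Fin q} (apart : Apart i j) (g : Values q) where
  open Apart apart
  open ≡-Reasoning

  commute-left : sortStep (sortStep g i) j (inject₁ i) ≡ sortStep (sortStep g j) i (inject₁ i)
  commute-left = begin
    sortStep (sortStep g i) j (inject₁ i)             ≡⟨ sortStep-away (sortStep g i) j ll lr ⟩
    sortStep g i (inject₁ i)                          ≡⟨ sortStep-left g i ⟩
    g (inject₁ i) ⊔ g (fsuc i)                        ≡⟨ cong₂ _⊔_ (sortStep-away g j ll lr) (sortStep-away g j rl rr) ⟨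
    sortStep g j (inject₁ i) ⊔ sortStep g j (fsuc i)  ≡⟨ sortStep-left (sortStep g j) i ⟨
    sortStep (sortStep g j) i (inject₁ i)             ∎

  commute-right : sortStep (sortStep g i) j (fsuc i) ≡ sortStep (sortStep g j) i (fsuc i)
  commute-right = begin
    sortStep (sortStep g i) j (fsuc i)                ≡⟨ sortStep-away (sortStep g i) j rl rr ⟩
    sortStep g i (fsuc i)                             ≡⟨ sortStep-right g i ⟩
    g (inject₁ i) ⊓ g (fsuc i)                        ≡⟨ cong₂ _⊓_ (sortStep-away g j ll lr) (sortStep-away g j rl rr) ⟨
    sortStep g j (inject₁ i) ⊓ sortStep g j (fsuc i)  ≡⟨ sortStep-right (sortStep g j) i ⟨
    sortStep (sortStep g j) i (fsuc i)                ∎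

∼-comm : ∀ {q} (i j : Fin q) → 2 ≤ dist i j → (i ∷ j ∷ []) ∼ (j ∷ i ∷ [])
∼-comm i j far = act-eq commute
  where
  apart : Apart i j
  apart = far⇒apart i j far
  commute : ∀ g x → sortStep (sortStep g i) j x ≡ sortStep (sortStep g j) i x
  commute g x with position i x | position j x
  ... | left | _ = commute-left apart g
  ... | right | _ = commute-right apart g
  ... | away _ _ | left = sym (commute-left (apart-sym apart) g)
  ... | away _ _ | right = sym (commute-right (apart-sym apart) g)
  ... | away ≢il ≢ir | away ≢jl ≢jr = begin
    sortStep (sortStep g i) j x  ≡⟨ sortStep-away (sortStep g i) j ≢jl ≢jr ⟩
    sortStep g i x               ≡⟨ sortStep-away g i ≢il ≢ir ⟩
    g x                          ≡⟨ sortStep-away g j ≢jl ≢jr ⟨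
    sortStep g j x               ≡⟨ sortStep-away (sortStep g j) i ≢il ≢ir ⟨
    sortStep (sortStep g j) i x  ∎
    where open ≡-Reasoning

sortFront sortBack : ℕ × ℕ × ℕ → ℕ × ℕ × ℕ
sortFront (a , b , c) = a ⊔ b , a ⊓ b , c
sortBack (a , b , c) = a , b ⊔ c , b ⊓ c

-- Both braid words put the maximum first, the median second and the
-- minimum last.
max-by-braid : ∀ a b c → (a ⊔ b) ⊔ ((a ⊓ b) ⊔ c) ≡ a ⊔ (b ⊔ c)
max-by-braid a b c = begin
  (a ⊔ b) ⊔ ((a ⊓ b) ⊔ c)  ≡⟨ ⊔-assoc (a ⊔ b) (a ⊓ b) c ⟨
  ((a ⊔ b) ⊔ (a ⊓ b)) ⊔ c  ≡⟨ cong (_⊔ c) (m≥n⇒m⊔n≡m (m⊓n≤m⊔n a b)) ⟩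
  (a ⊔ b) ⊔ c              ≡⟨ ⊔-assoc a b c ⟩
  a ⊔ (b ⊔ c)              ∎
  where open ≡-Reasoning

median-by-braid : ∀ a b c → (a ⊔ b) ⊓ ((a ⊓ b) ⊔ c) ≡ (a ⊓ (b ⊔ c)) ⊔ (b ⊓ c)
median-by-braid zero zero c = refl
median-by-braid zero (suc b) zero = refl
median-by-braid zero (suc b) (suc c) = refl
median-by-braid (suc a) zero zero = refl
median-by-braid (suc a) zero (suc c) = refl
median-by-braid (suc a) (suc b) zero = cong suc (m≥n⇒m⊓n≡n (m⊓n≤m⊔n a b))
median-by-braid (suc a) (suc b) (suc c) = cong suc (median-by-braid a b c)

min-by-braid : ∀ a b c → (a ⊓ b) ⊓ c ≡ (a ⊓ (b ⊔ c)) ⊓ (b ⊓ c)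
min-by-braid a b c = begin
  (a ⊓ b) ⊓ c              ≡⟨ ⊓-assoc a b c ⟩
  a ⊓ (b ⊓ c)              ≡⟨ cong (a ⊓_) (m≥n⇒m⊓n≡n (m⊓n≤m⊔n b c)) ⟨
  a ⊓ ((b ⊔ c) ⊓ (b ⊓ c))  ≡⟨ ⊓-assoc a (b ⊔ c) (b ⊓ c) ⟨
  (a ⊓ (b ⊔ c)) ⊓ (b ⊓ c)  ∎
  where open ≡-Reasoning

sort3-braid : ∀ t → sortFront (sortBack (sortFront t)) ≡ sortBack (sortFront (sortBack t))
sort3-braid (a , b , c) = cong₂ _,_ (max-by-braid a b c) (cong₂ _,_ (median-by-braid a b c) (min-by-braid a b c))

-- For adjacent letters i, j = i+1 both braid words act on the positions
-- i, i+1, i+2 as in sort3-braid and fix every other position.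
module Braid {q} {i j : Fin q} (adjacent : toℕ j ≡ suc (toℕ i)) where
  open ≡-Reasoning

  P0 P1 P2 : Fin (suc q)
  P0 = inject₁ i
  P1 = fsuc i
  P2 = fsuc j

  shared : inject₁ j ≡ P1
  shared = toℕ-injective (trans (toℕ-inject₁ j) adjacent)

  P0≢P1 : P0 ≢ P1
  P0≢P1 e = 1+n≢n (sym (trans (sym (toℕ-inject₁ i)) (cong toℕ e)))

  P0≢P2 : P0 ≢ P2
  P0≢P2 e = <-irrefl (trans (sym (toℕ-inject₁ i)) (trans (cong toℕ e) (cong suc adjacent)))
                     (s≤s (n≤1+n (toℕ i)))

  P1≢P2 : P1 ≢ P2
  P1≢P2 e = 1+n≢n (sym (trans (suc-injective (cong toℕ e)) adjacent))

  window : Values q → ℕ × ℕ × ℕ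
  window h = h P0 , h P1 , h P2

  window-i : ∀ h → window (sortStep h i) ≡ sortFront (window h)
  window-i h = cong₂ _,_ (sortStep-left h i) (cong₂ _,_ (sortStep-right h i)
                 (sortStep-away h i (P0≢P2 ∘ sym) (P1≢P2 ∘ sym)))

  window-j : ∀ h → window (sortStep h j) ≡ sortBack (window h)
  window-j h = cong₂ _,_ (sortStep-away h j (λ e → P0≢P1 (trans e shared)) P0≢P2)
                 (cong₂ _,_ (subst (λ p → sortStep h j p ≡ h p ⊔ h P2) shared (sortStep-left h j))
                            (subst (λ p → sortStep h j P2 ≡ h p ⊓ h P2) shared (sortStep-right h j)))

  window-braid : ∀ g → window (sortBy g (i ∷ j ∷ i ∷ [])) ≡ window (sortBy g (j ∷ i ∷ j ∷ []))
  window-braid g = begin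
    window (sortStep (sortStep (sortStep g i) j) i)  ≡⟨ window-i (sortStep (sortStep g i) j) ⟩
    sortFront (window (sortStep (sortStep g i) j))   ≡⟨ cong sortFront (trans (window-j (sortStep g i)) (cong sortBack (window-i g))) ⟩
    sortFront (sortBack (sortFront (window g)))      ≡⟨ sort3-braid (window g) ⟩
    sortBack (sortFront (sortBack (window g)))       ≡⟨ cong sortBack (trans (window-i (sortStep g j)) (cong sortFront (window-j g))) ⟨
    sortBack (window (sortStep (sortStep g j) i))    ≡⟨ window-j (sortStep (sortStep g j) i) ⟨
    window (sortStep (sortStep (sortStep g j) i) j)  ∎

  data Place : Fin (suc q) → Set where
    at0 : Place P0
    at1 : Place P1
    at2 : Place P2
    outside : ∀ {x} → x ≢ P0 → x ≢ P1 → x ≢ P2 → Place x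

  place : ∀ x → Place x
  place x with x ≟F P0 | x ≟F P1 | x ≟F P2
  ... | yes refl | _ | _ = at0
  ... | no _ | yes refl | _ = at1
  ... | no _ | no _ | yes refl = at2
  ... | no ≢0 | no ≢1 | no ≢2 = outside ≢0 ≢1 ≢2

  ∼-braid-adjacent : (i ∷ j ∷ i ∷ []) ∼ (j ∷ i ∷ j ∷ [])
  ∼-braid-adjacent = act-eq braided
    where
    braided : ∀ g x → sortBy g (i ∷ j ∷ i ∷ []) x ≡ sortBy g (j ∷ i ∷ j ∷ []) x
    braided g x with place x
    ... | at0 = cong proj₁ (window-braid g)
    ... | at1 = cong (proj₁ ∘ proj₂) (window-braid g)
    ... | at2 = cong (proj₂ ∘ proj₂) (window-braid g)
    ... | outside ≢0 ≢1 ≢2 = begin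
      sortStep (sortStep (sortStep g i) j) i x  ≡⟨ sortStep-away (sortStep (sortStep g i) j) i ≢0 ≢1 ⟩
      sortStep (sortStep g i) j x               ≡⟨ sortStep-away (sortStep g i) j ≢j ≢2 ⟩
      sortStep g i x                            ≡⟨ sortStep-away g i ≢0 ≢1 ⟩
      g x                                       ≡⟨ sortStep-away g j ≢j ≢2 ⟨
      sortStep g j x                            ≡⟨ sortStep-away (sortStep g j) i ≢0 ≢1 ⟨
      sortStep (sortStep g j) i x               ≡⟨ sortStep-away (sortStep (sortStep g j) i) j ≢j ≢2 ⟨
      sortStep (sortStep (sortStep g j) i) j x  ∎
      where ≢j = λ e → ≢1 (trans e shared)

dist-sym : ∀ {q} (i j : Fin q) → dist i j ≡ dist j i
dist-sym i j = +-comm (toℕ i ∸ toℕ j) (toℕ j ∸ toℕ i)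

compare-letters : ∀ a b → b ≡ suc a ⊎ a ≡ suc b ⊎ a ≡ b ⊎ 2 ≤ (a ∸ b) + (b ∸ a)
compare-letters zero zero = inj₂ (inj₂ (inj₁ refl))
compare-letters zero (suc zero) = inj₁ refl
compare-letters zero (suc (suc b)) = inj₂ (inj₂ (inj₂ (s≤s (s≤s z≤n))))
compare-letters (suc zero) zero = inj₂ (inj₁ refl)
compare-letters (suc (suc a)) zero = inj₂ (inj₂ (inj₂ (s≤s (s≤s z≤n))))
compare-letters (suc a) (suc b) with compare-letters a b
... | inj₁ e = inj₁ (cong suc e)
... | inj₂ (inj₁ e) = inj₂ (inj₁ (cong suc e))
... | inj₂ (inj₂ (inj₁ e)) = inj₂ (inj₂ (inj₁ (cong suc e)))
... | inj₂ (inj₂ (inj₂ d)) = inj₂ (inj₂ (inj₂ d))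

∼-braid : ∀ {q} (i j : Fin q) → (i ∷ j ∷ i ∷ []) ∼ (j ∷ i ∷ j ∷ [])
∼-braid i j with compare-letters (toℕ i) (toℕ j)
... | inj₁ j≡1+i = Braid.∼-braid-adjacent j≡1+i
... | inj₂ (inj₁ i≡1+j) = ∼-sym (Braid.∼-braid-adjacent i≡1+j)
... | inj₂ (inj₂ (inj₁ i≡j)) rewrite toℕ-injective i≡j = ∼-refl
... | inj₂ (inj₂ (inj₂ far)) =
  -- far apart, both sides collapse to i j
  ∼-trans (∼-trans (∼-prefix (i ∷ []) (∼-comm j i far′)) (∼-suffix (j ∷ []) (∼-idem i)))
          (∼-sym (∼-trans (∼-suffix (j ∷ []) (∼-comm j i far′)) (∼-prefix (i ∷ []) (∼-idem j))))
  where
  far′ : 2 ≤ dist j i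
  far′ = subst (2 ≤_) (dist-sym i j) far

HeckeRel⇒∼ : ∀ {q} {l r : Word q} → HeckeRel l r → l ∼ r
HeckeRel⇒∼ (idem i) = ∼-idem i
HeckeRel⇒∼ (braid i j) = ∼-braid i j
HeckeRel⇒∼ (comm i j far) = ∼-comm i j far

≈H⇒∼ : ∀ {q} {u v : Word q} → u ≈H v → u ∼ v
≈H⇒∼ (step u v l r rel) = ∼-prefix u (∼-suffix v (HeckeRel⇒∼ rel))
≈H⇒∼ ≈refl = ∼-refl
≈H⇒∼ (≈sym u≈v) = ∼-sym (≈H⇒∼ u≈v)
≈H⇒∼ (≈trans u≈v v≈w) = ∼-trans (≈H⇒∼ u≈v) (≈H⇒∼ v≈w)

countInv-tabulate : ∀ {q n} (π : Perm q) i (f : Fin n → Fin (suc q)) →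
  countInv π i (tabulate f) ≡ sum (λ j → inverted (toℕ ∘ lookup π) i (f j))
countInv-tabulate {n = zero} π i f = refl
countInv-tabulate {n = suc n} π i f
  with toℕ i <? toℕ (f fzero) | toℕ (lookup π (f fzero)) <? toℕ (lookup π i)
... | yes _ | yes _ = cong suc (countInv-tabulate π i (f ∘ fsuc))
... | yes _ | no _ = countInv-tabulate π i (f ∘ fsuc)
... | no _ | _ = countInv-tabulate π i (f ∘ fsuc)

invs-tabulate : ∀ {q n} (π : Perm q) (f : Fin n → Fin (suc q)) →
  invs π (tabulate f) ≡ sum (λ i → countInv π (f i) (allFin (suc q)))
invs-tabulate {n = zero} π f = refl
invs-tabulate {q} {suc n} π f = cong (countInv π (f fzero) (allFin (suc q)) +_) (invs-tabulate π (f ∘ fsuc))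

ℓ≡inversions : ∀ {q} (π : Perm q) → ℓ π ≡ inversions (toℕ ∘ lookup π)
ℓ≡inversions π = trans (invs-tabulate π (λ i → i)) (sum-cong-≗ λ i → countInv-tabulate π i (λ j → j))

lookup-swapAt : ∀ {q} (π : Perm q) k x → lookup (swapAt π k) x ≡ lookup π (swapIx k x)
lookup-swapAt π k x with position k x
... | left = trans (lookup∘update′ l≢r (π [ inject₁ k ]≔ lookup π (fsuc k)) (lookup π (inject₁ k)))
                   (trans (lookup∘update (inject₁ k) π (lookup π (fsuc k))) (cong (lookup π) (sym (swapIx-left k))))
  where
  l≢r : inject₁ k ≢ fsuc k
  l≢r e = 1+n≢n (sym (trans (sym (toℕ-inject₁ k)) (cong toℕ e)))
... | right = trans (lookup∘update (fsuc k) (π [ inject₁ k ]≔ lookup π (fsuc k)) (lookup π (inject₁ k)))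
                    (cong (lookup π) (sym (swapIx-right k)))
... | away ≢l ≢r = trans (lookup∘update′ ≢r (π [ inject₁ k ]≔ lookup π (fsuc k)) (lookup π (inject₁ k)))
                         (trans (lookup∘update′ ≢l π (lookup π (fsuc k))) (cong (lookup π) (sym (swapIx-away k x ≢l ≢r))))

-- The values of s_{i1} ⋯ s_{ik}, obtained by performing the swaps unconditionally.
swapsBy : ∀ {q} → Values q → Word q → Values q
swapsBy = foldl λ g k → g ∘ swapIx k

permOf-values : ∀ {q} (u : Word q) → toℕ ∘ lookup (permOf u) ≗ swapsBy toℕ u
permOf-values {q} u = go (allFin (suc q)) u toℕ (cong toℕ ∘ lookup-allFin)
  where
  go : ∀ π u g → toℕ ∘ lookup π ≗ g → toℕ ∘ lookup (foldl swapAt π u) ≗ swapsBy g u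
  go π [] g π≗g = π≗g
  go π (k ∷ u) g π≗g = go (swapAt π k) u (g ∘ swapIx k) λ x →
    trans (cong toℕ (lookup-swapAt π k x)) (π≗g (swapIx k x))

inversions-swap≤ : ∀ {q} (g : Values q) k → inversions (g ∘ swapIx k) ≤ inversions g + 1
inversions-swap≤ g k = ≤-trans (inversions-swap g k) (+-monoʳ-≤ (inversions g) (𝟙≤1 _))

inversions-sortStep : ∀ {q} (g : Values q) k → inversions (sortStep g k) ≤ inversions g + 1
inversions-sortStep g k with sortStep-cases g k
... | inj₁ (_ , eq) rewrite eq = inversions-swap≤ g k
... | inj₂ (_ , eq) rewrite eq = m≤m+n (inversions g) 1

inversions-foldl : ∀ {q} (next : Values q → Fin q → Values q) →
  (∀ g k → inversions (next g k) ≤ inversions g + 1) →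
  ∀ g u → inversions (foldl next g u) ≤ inversions g + length u
inversions-foldl next next≤ g [] = ≤-reflexive (sym (+-identityʳ (inversions g)))
inversions-foldl next next≤ g (k ∷ u) = begin
  inversions (foldl next (next g k) u)  ≤⟨ inversions-foldl next next≤ (next g k) u ⟩
  inversions (next g k) + length u      ≤⟨ +-monoˡ-≤ (length u) (next≤ g k) ⟩
  inversions g + 1 + length u           ≡⟨ +-assoc (inversions g) 1 (length u) ⟩
  inversions g + suc (length u)         ∎
  where open ≤-Reasoning

-- If the swaps along u create a new inversion at every letter, then every
-- sorting step along u swaps, so sorting and swapping agree.
sortBy-reduced : ∀ {q} (g : Values q) u → inversions g + length u ≤ inversions (swapsBy g u) →
                 sortBy g u ≗ swapsBy g u
sortBy-reduced g [] _ x = refl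
sortBy-reduced g (k ∷ u) tight with sortStep-cases g k
... | inj₁ (_ , eq) = λ x → trans (sortBy-cong (λ y → cong (λ f → f y) eq) u x)
                                  (sortBy-reduced (g ∘ swapIx k) u tight′ x)
  where
  tight′ : inversions (g ∘ swapIx k) + length u ≤ inversions (swapsBy (g ∘ swapIx k) u)
  tight′ = begin
    inversions (g ∘ swapIx k) + length u   ≤⟨ +-monoˡ-≤ (length u) (inversions-swap≤ g k) ⟩
    inversions g + 1 + length u            ≡⟨ +-assoc (inversions g) 1 (length u) ⟩
    inversions g + suc (length u)          ≤⟨ tight ⟩
    inversions (swapsBy (g ∘ swapIx k) u)  ∎
    where open ≤-Reasoning
... | inj₂ (¬asc , _) = contradiction tight (<⇒≱ too-few)
  where
  -- swapping a descent creates no inversion, and the remaining letters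
  -- cannot make up for it
  no-new : inversions (g ∘ swapIx k) ≤ inversions g
  no-new = ≤-trans (inversions-swap g k) (≤-reflexive
    (trans (cong (inversions g +_) (𝟙-no (g (inject₁ k) <? g (fsuc k)) ¬asc)) (+-identityʳ (inversions g))))
  too-few : inversions (swapsBy (g ∘ swapIx k) u) < inversions g + suc (length u)
  too-few = begin-strict
    inversions (swapsBy (g ∘ swapIx k) u)  ≤⟨ inversions-foldl _ inversions-swap≤ (g ∘ swapIx k) u ⟩
    inversions (g ∘ swapIx k) + length u   ≤⟨ +-monoˡ-≤ (length u) no-new ⟩
    inversions g + length u                <⟨ +-monoʳ-< (inversions g) (n<1+n (length u)) ⟩
    inversions g + suc (length u)          ∎
    where open ≤-Reasoning

ℓ-of-W : ∀ {q} (w : Word q) (π : Perm q) → IsW w π → ℓ π ≡ inversions (sortBy toℕ w)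
ℓ-of-W {q} w π (u , w≈u , permOf-u≡π , length-u≡ℓ) = begin
    ℓ π                         ≡⟨ ℓ≡swaps ⟩
    inversions (swapsBy toℕ u)  ≡⟨ inversions-cong (sortBy-reduced toℕ u tight) ⟨
    inversions (sortBy toℕ u)   ≡⟨ inversions-cong (act (≈H⇒∼ w≈u) toℕ) ⟨
    inversions (sortBy toℕ w)   ∎
  where
  open ≡-Reasoning
  ℓ≡swaps : ℓ π ≡ inversions (swapsBy toℕ u)
  ℓ≡swaps = begin
    ℓ π                                   ≡⟨ ℓ≡inversions π ⟩
    inversions (toℕ ∘ lookup π)           ≡⟨ cong (λ σ → inversions (toℕ ∘ lookup σ)) permOf-u≡π ⟨
    inversions (toℕ ∘ lookup (permOf u))  ≡⟨ inversions-cong (permOf-values u) ⟩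
    inversions (swapsBy toℕ u)            ∎
  -- u is reduced: its length is the length of the permutation it spells
  tight : inversions {q} toℕ + length u ≤ inversions (swapsBy toℕ u)
  tight = ≤-reflexive (trans (cong (_+ length u) (inversions-id {q})) (trans length-u≡ℓ ℓ≡swaps))

module _ {A : Set} where

  length-snoc : ∀ (c : List A) x → length (c ++ [ x ]) ≡ suc (length c)
  length-snoc c x = trans (length-++ c) (+-comm (length c) 1)

  ⊆-snoc-split : ∀ {s : List A} u y → s ⊆ u ++ [ y ] → s ⊆ u ⊎ ∃ λ s₀ → s ≡ s₀ ++ [ y ] × s₀ ⊆ u
  ⊆-snoc-split [] y (.y ∷ʳ p) = inj₁ p
  ⊆-snoc-split [] y (refl ∷ []) = inj₂ ([] , refl , [])
  ⊆-snoc-split (e ∷ u) y (.e ∷ʳ p) with ⊆-snoc-split u y p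
  ... | inj₁ p′ = inj₁ (e ∷ʳ p′)
  ... | inj₂ (s₀ , eq , p₀) = inj₂ (s₀ , eq , e ∷ʳ p₀)
  ⊆-snoc-split (e ∷ u) y (refl ∷ p) with ⊆-snoc-split u y p
  ... | inj₁ p′ = inj₁ (refl ∷ p′)
  ... | inj₂ (s₀ , refl , p₀) = inj₂ (e ∷ s₀ , refl , refl ∷ p₀)

  module _ {R : Rel A 0ℓ} where

    linked-snoc : ∀ {s x} → Linked R s → All (λ e → R e x) s → Linked R (s ++ [ x ])
    linked-snoc [] [] = [-]
    linked-snoc [-] (r ∷ []) = r ∷ [-]
    linked-snoc (r ∷ l) (_ ∷ rs) = r ∷ linked-snoc l rs

    linked-init : ∀ s {x} → Linked R (s ++ [ x ]) → Linked R s
    linked-init [] l = []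
    linked-init (y ∷ []) l = [-]
    linked-init (y ∷ y′ ∷ s) (r ∷ l) = r ∷ linked-init (y′ ∷ s) l

    linked-last : Transitive R → ∀ s {x} → Linked R (s ++ [ x ]) → All (λ e → R e x) s
    linked-last tr [] l = []
    linked-last tr (y ∷ []) (r ∷ [-]) = r ∷ []
    linked-last tr (y ∷ y′ ∷ s) (r ∷ l) with linked-last tr (y′ ∷ s) l
    ... | r′ ∷ rs = tr r r′ ∷ r′ ∷ rs

    linked-first : Transitive R → ∀ {r rs} → Linked R (r ∷ rs) → All (R r) rs
    linked-first tr [-] = []
    linked-first tr (p ∷ l) = Linked⇒All tr p l

Row : ∀ {q} → Word q → Set
Row = Linked _<L_

row-first : ∀ {q} {r : Fin q} {rs} → Row (r ∷ rs) → All (r <L_) rs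
row-first = linked-first <-trans

row-cons : ∀ {q} {r : Fin q} {rs} → All (r <L_) rs → Row rs → Row (r ∷ rs)
row-cons [] [] = [-]
row-cons (r< ∷ _) rs↑ = r< ∷ rs↑

first : ∀ {A : Set} → List A → List A
first [] = []
first (r ∷ _) = [ r ]

-- Hecke row insertion of x into a row, returning (bumped letters, new row).
insert : ∀ {q} → Fin q → Word q → Word q × Word q
insertAt : ∀ {q} (x r : Fin q) rs → Tri (x <L r) (toℕ x ≡ toℕ r) (r <L x) → Word q × Word q
insert x [] = [] , [ x ]
insert x (r ∷ rs) = insertAt x r rs (<-cmp (toℕ x) (toℕ r))
insertAt x r rs (tri< _ _ _) = [ r ] , x ∷ rs
insertAt x r rs (tri≈ _ _ _) = first rs , r ∷ rs
insertAt x r rs (tri> _ _ _) = proj₁ (insert x rs) , r ∷ proj₂ (insert x rs)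

bumped newRow : ∀ {q} → Fin q → Word q → Word q
bumped x R = proj₁ (insert x R)
newRow x R = proj₂ (insert x R)

insert-all : ∀ {q} {P : Fin q → Set} x R → P x → All P R → All P (newRow x R)
insert-all x [] px [] = px ∷ []
insert-all x (r ∷ rs) px (pr ∷ ps) = go (<-cmp (toℕ x) (toℕ r))
  where
  go : (t : Tri _ _ _) → All _ (proj₂ (insertAt x r rs t))
  go (tri< _ _ _) = px ∷ ps
  go (tri≈ _ _ _) = pr ∷ ps
  go (tri> _ _ _) = pr ∷ insert-all x rs px ps

insert-row : ∀ {q} (x : Fin q) R → Row R → Row (newRow x R)
insert-row x [] _ = [-]
insert-row x (r ∷ rs) R↑ = go (<-cmp (toℕ x) (toℕ r))
  where
  go : (t : Tri _ _ _) → Row (proj₂ (insertAt x r rs t))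
  go (tri< x<r _ _) = replace-first R↑
    where
    replace-first : ∀ {rs} → Row (r ∷ rs) → Row (x ∷ rs)
    replace-first [-] = [-]
    replace-first (r<r′ ∷ rs↑) = <-trans x<r r<r′ ∷ rs↑
  go (tri≈ _ _ _) = R↑
  go (tri> _ _ r>x) = row-cons (insert-all x rs r>x (row-first R↑)) (insert-row x rs (Linked.tail R↑))

insert-∈ : ∀ {q} (x : Fin q) R {e} → e ∈ newRow x R → e ≡ x ⊎ e ∈ R
insert-∈ x [] (here refl) = inj₁ refl
insert-∈ x (r ∷ rs) {e} = go (<-cmp (toℕ x) (toℕ r))
  where
  go : (t : Tri _ _ _) → e ∈ proj₂ (insertAt x r rs t) → e ≡ x ⊎ e ∈ r ∷ rs
  go (tri< _ _ _) (here refl) = inj₁ refl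
  go (tri< _ _ _) (there e∈) = inj₂ (there e∈)
  go (tri≈ _ _ _) e∈ = inj₂ e∈
  go (tri> _ _ _) (here refl) = inj₂ (here refl)
  go (tri> _ _ _) (there e∈) with insert-∈ x rs e∈
  ... | inj₁ e≡x = inj₁ e≡x
  ... | inj₂ e∈rs = inj₂ (there e∈rs)

data Bump {q} (x : Fin q) (R R′ : Word q) : Word q → Set where
  none : Bump x R R′ []
  one  : ∀ {y} → y ∈ R → x <L y → (∀ {r} → r ∈ R′ → r <L y → toℕ r ≤ toℕ x) → Bump x R R′ [ y ]

bump : ∀ {q} (x : Fin q) R → Row R → Bump x R (newRow x R) (bumped x R)
bump x [] _ = none
bump x (r ∷ rs) R↑ = go (<-cmp (toℕ x) (toℕ r))
  where
  go : (t : Tri _ _ _) → Bump x (r ∷ rs) (proj₂ (insertAt x r rs t)) (proj₁ (insertAt x r rs t))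
  go (tri< x<r _ _) = one (here refl) x<r below-r
    where
    below-r : ∀ {e} → e ∈ x ∷ rs → e <L r → toℕ e ≤ toℕ x
    below-r (here refl) _ = ≤-refl
    below-r (there e∈) e<r = contradiction (All.lookup (row-first R↑) e∈) (<-asym e<r)
  go (tri≈ _ x≡r _) = next rs R↑
    where
    next : ∀ rs → Row (r ∷ rs) → Bump x (r ∷ rs) (r ∷ rs) (first rs)
    next [] _ = none
    next (r′ ∷ rs′) (r<r′ ∷ rs↑) = one (there (here refl)) (subst (_< toℕ r′) (sym x≡r) r<r′) below-r′
      where
      below-r′ : ∀ {e} → e ∈ r ∷ r′ ∷ rs′ → e <L r′ → toℕ e ≤ toℕ x
      below-r′ (here refl) _ = ≤-reflexive (sym x≡r)
      below-r′ (there (here refl)) e<r′ = contradiction e<r′ (<-irrefl refl)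
      below-r′ (there (there e∈)) e<r′ = contradiction (All.lookup (row-first rs↑) e∈) (<-asym e<r′)
  go (tri> _ _ r<x) with bumped x rs | bump x rs (Linked.tail R↑)
  ... | .[] | none = none
  ... | .([ _ ]) | one y∈ x<y below-y = one (there y∈) x<y below-y′
    where
    below-y′ : ∀ {e} → e ∈ r ∷ newRow x rs → e <L _ → toℕ e ≤ toℕ x
    below-y′ (here refl) _ = <⇒≤ r<x
    below-y′ (there e∈) = below-y e∈

below : ∀ {q} → Word q → ℕ → ℕ
below [] v = 0
below (r ∷ rs) v = 𝟙 (toℕ r <? v) + below rs v

below-mono : ∀ {q} (R : Word q) {a b} → a ≤ b → below R a ≤ below R b
below-mono [] a≤b = z≤n
below-mono (r ∷ R) {a} {b} a≤b =
  +-mono-≤ (𝟙-mono (λ r<a → <-≤-trans r<a a≤b) (toℕ r <? a) (toℕ r <? b)) (below-mono R a≤b)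

below-none : ∀ {q} (R : Word q) {v} → All (λ e → v ≤ toℕ e) R → below R v ≡ 0
below-none [] [] = refl
below-none (r ∷ R) {v} (v≤r ∷ ps) = cong₂ _+_ (𝟙-no (toℕ r <? v) (≤⇒≯ v≤r)) (below-none R ps)

below-all : ∀ {q} (R : Word q) → below R q ≡ length R
below-all [] = refl
below-all {q} (r ∷ R) = cong₂ _+_ (𝟙-yes (toℕ r <? q) (toℕ<n r)) (below-all R)

below-∈ : ∀ {q} (R : Word q) {y v} → y ∈ R → toℕ y < v → suc (below R (toℕ y)) ≤ below R v
below-∈ (r ∷ R) {y} {v} (here refl) y<v
  rewrite 𝟙-no (toℕ y <? toℕ y) (<-irrefl refl) | 𝟙-yes (toℕ y <? v) y<v = s≤s (below-mono R (<⇒≤ y<v))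
below-∈ (r ∷ R) {y} {v} (there y∈) y<v = begin
  suc (𝟙 (toℕ r <? toℕ y) + below R (toℕ y))  ≡⟨ +-suc _ _ ⟨
  𝟙 (toℕ r <? toℕ y) + suc (below R (toℕ y))  ≤⟨ +-mono-≤ (𝟙-mono (λ r<y → <-trans r<y y<v) (toℕ r <? toℕ y) (toℕ r <? v)) (below-∈ R y∈ y<v) ⟩
  𝟙 (toℕ r <? v) + below R v                  ∎
  where open ≤-Reasoning

below-insert-≥ : ∀ {q} (x : Fin q) R v → below R v ≤ below (newRow x R) v
below-insert-≥ x [] v = z≤n
below-insert-≥ x (r ∷ rs) v = go (<-cmp (toℕ x) (toℕ r))
  where
  go : (t : Tri _ _ _) → below (r ∷ rs) v ≤ below (proj₂ (insertAt x r rs t)) v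
  go (tri< x<r _ _) = +-monoˡ-≤ (below rs v) (𝟙-mono (<-trans x<r) (toℕ r <? v) (toℕ x <? v))
  go (tri≈ _ _ _) = ≤-refl
  go (tri> _ _ _) = +-monoʳ-≤ (𝟙 (toℕ r <? v)) (below-insert-≥ x rs v)

below-insert-≤ : ∀ {q} (x : Fin q) R → Row R → ∀ v →
  below (newRow x R) v ≤ below R v ⊎ (toℕ x < v × below (newRow x R) v ≤ suc (below R (toℕ x)))
below-insert-≤ x [] _ v with toℕ x <? v
... | yes x<v = inj₂ (x<v , s≤s z≤n)
... | no _ = inj₁ z≤n
below-insert-≤ x (r ∷ rs) R↑ v = go (<-cmp (toℕ x) (toℕ r))
  where
  go : (t : Tri _ _ _) → below (proj₂ (insertAt x r rs t)) v ≤ below (r ∷ rs) v ⊎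
         (toℕ x < v × below (proj₂ (insertAt x r rs t)) v ≤ suc (below (r ∷ rs) (toℕ x)))
  go (tri< x<r _ _) with toℕ x <? v | toℕ r <? v
  ... | no _ | _ = inj₁ (m≤n+m (below rs v) _)
  ... | yes _ | yes _ = inj₁ ≤-refl
  ... | yes x<v | no r≮v = inj₂ (x<v , s≤s (≤-trans (≤-reflexive nothing-below) z≤n))
    where
    nothing-below : below rs v ≡ 0
    nothing-below = below-none rs (All.map (λ r<e → ≤-trans (≮⇒≥ r≮v) (<⇒≤ r<e)) (row-first R↑))
  go (tri≈ _ _ _) = inj₁ ≤-refl
  go (tri> _ _ r<x) with below-insert-≤ x rs (Linked.tail R↑) v
  ... | inj₁ le = inj₁ (+-monoʳ-≤ (𝟙 (toℕ r <? v)) le)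
  ... | inj₂ (x<v , le) = inj₂ (x<v , (begin
    𝟙 (toℕ r <? v) + below (newRow x rs) v  ≤⟨ +-mono-≤ (𝟙≤1 (toℕ r <? v)) le ⟩
    suc (suc (below rs (toℕ x)))            ≡⟨ cong (λ c → suc (c + below rs (toℕ x))) (𝟙-yes (toℕ r <? toℕ x) r<x) ⟨
    suc (𝟙 (toℕ r <? toℕ x) + below rs (toℕ x)) ∎))
    where open ≤-Reasoning

row-length : ∀ {q} (R : Word q) lo → Row R → All (λ e → lo ≤ toℕ e) R → length R ≤ q ∸ lo
row-length [] lo _ _ = z≤n
row-length {q} (r ∷ R) lo R↑ (lo≤r ∷ lo≤R) = begin
  suc (length R)       ≤⟨ s≤s (row-length R (suc lo) (Linked.tail R↑) (All.map (≤-<-trans lo≤r) (row-first R↑))) ⟩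
  suc (q ∸ suc lo)     ≡⟨ +-∸-assoc 1 lo<q ⟨
  suc q ∸ suc lo       ∎
  where
  open ≤-Reasoning
  lo<q : lo < q
  lo<q = ≤-<-trans lo≤r (toℕ<n r)

far-above : ∀ {q} (e x : Fin q) → suc (toℕ x) < toℕ e → 2 ≤ dist e x
far-above e x x+1<e = ≤-trans (m+n≤o⇒m≤o∸n 2 x+1<e) (m≤m+n (toℕ e ∸ toℕ x) (toℕ x ∸ toℕ e))

∼-pass : ∀ {q} (rs : Word q) x → All (λ e → suc (toℕ x) < toℕ e) rs → (rs ++ [ x ]) ∼ (x ∷ rs)
∼-pass [] x [] = ∼-refl
∼-pass (e ∷ rs) x (x+1<e ∷ far) =
  ∼-trans (∼-prefix [ e ] (∼-pass rs x far)) (∼-suffix rs (∼-comm e x (far-above e x x+1<e)))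

beyond : ∀ {q} {x r : Fin q} {rs} → x <L r → Row (r ∷ rs) → All (λ e → suc (toℕ x) < toℕ e) rs
beyond x<r R↑ = All.map (λ r<e → ≤-trans (s≤s x<r) r<e) (row-first R↑)

insert-∼ : ∀ {q} (x : Fin q) R → Row R → (R ++ [ x ]) ∼ (bumped x R ++ newRow x R)
insert-∼ x [] _ = ∼-refl
insert-∼ x (r ∷ rs) R↑ = go (<-cmp (toℕ x) (toℕ r))
  where
  go : (t : Tri _ _ _) → (r ∷ rs ++ [ x ]) ∼ (proj₁ (insertAt x r rs t) ++ proj₂ (insertAt x r rs t))
  -- r rs x ∼ r x rs: x passes the entries after r
  go (tri< x<r _ _) = ∼-prefix [ r ] (∼-pass rs x (beyond x<r R↑))
  -- x rs x ∼ first rs x rs, by idempotence or by a braid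
  go (tri≈ _ x≡r _) rewrite toℕ-injective x≡r = equal rs R↑
    where
    equal : ∀ rs → Row (r ∷ rs) → (r ∷ rs ++ [ r ]) ∼ (first rs ++ r ∷ rs)
    equal [] _ = ∼-idem r
    equal (r′ ∷ rs′) (r<r′ ∷ R↑′) =
      ∼-trans (∼-prefix (r ∷ r′ ∷ []) (∼-pass rs′ r (beyond r<r′ R↑′))) (∼-suffix rs′ (∼-braid r r′))
  -- r rs x ∼ r (bumped) (new row) ∼ (bumped) r (new row), as a bumped y exceeds x > r
  go (tri> _ _ r<x) = ∼-trans (∼-prefix [ r ] (insert-∼ x rs (Linked.tail R↑))) (move-r (bump x rs (Linked.tail R↑)))
    where
    move-r : ∀ {b} → Bump x rs (newRow x rs) b → (r ∷ b ++ newRow x rs) ∼ (b ++ r ∷ newRow x rs)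
    move-r none = ∼-refl
    move-r (one {y} _ x<y _) =
      ∼-suffix (newRow x rs) (∼-comm r y (subst (2 ≤_) (dist-sym y r) (far-above y r (≤-trans (s≤s r<x) x<y))))

Decreasing : ∀ {q} → Word q → Set
Decreasing = Linked _>L_

-- Such lifts carry the
-- decreasing subsequences of the bumped word back to the original word,
-- one letter longer.
record DecreasingLift {q} (u R : Word q) (n y : ℕ) : Set where
  field
    chain     : Word q
    end       : Fin q
    occurs    : (chain ++ [ end ]) ⊆ u
    decreases : Decreasing (chain ++ [ end ])
    size      : length chain ≡ n
    above     : All (λ e → y ≤ toℕ e) chain
    dominates : ∀ {r} → r ∈ R → toℕ r < y → toℕ r ≤ toℕ end

-- Appending x to u and inserting it into R preserves a lift: if x < y and x
-- is above the old end, x becomes the new end.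
lift-insert : ∀ {q} {u R : Word q} {n y} x → DecreasingLift u R n y → DecreasingLift (u ++ [ x ]) (newRow x R) n y
lift-insert {R = R} {y = y} x L with toℕ x <? y | toℕ end <? toℕ x
  where open DecreasingLift L
... | yes x<y | yes end<x = record
  { chain = chain ; end = x
  ; occurs = ++⁺ (⊆-trans (++⁺ʳ [ end ] ⊆-refl) occurs) ⊆-refl
  ; decreases = linked-snoc (linked-init chain decreases) (All.map (λ y≤e → <-≤-trans x<y y≤e) above)
  ; size = size ; above = above
  ; dominates = λ r∈ r<y → [ (λ { refl → ≤-refl }) , (λ r∈R → ≤-trans (dominates r∈R r<y) (<⇒≤ end<x)) ]′ (insert-∈ x R r∈) }
  where open DecreasingLift L
... | yes _ | no end≮x = record
  { chain = chain ; end = end ; occurs = ++⁺ʳ [ x ] occurs ; decreases = decreases ; size = size ; above = above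
  ; dominates = λ r∈ r<y → [ (λ { refl → ≮⇒≥ end≮x }) , (λ r∈R → dominates r∈R r<y) ]′ (insert-∈ x R r∈) }
  where open DecreasingLift L
... | no x≮y | _ = record
  { chain = chain ; end = end ; occurs = ++⁺ʳ [ x ] occurs ; decreases = decreases ; size = size ; above = above
  ; dominates = λ r∈ r<y → [ (λ { refl → contradiction r<y x≮y }) , (λ r∈R → dominates r∈R r<y) ]′ (insert-∈ x R r∈) }
  where open DecreasingLift L

-- The state after row-inserting the letters of u one by one: w′ collects the
-- bumped letters and R is the row.  It records that the row witnesses and
-- bounds increasing subsequences (refined by an upper bound v), that
-- decreasing subsequences of w′ lift to longer ones of u, and that u ∼ w′ R.
record Insertion {q} (u w′ R : Word q) : Set where
  field
    row↑     : Row R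
    row⊆     : ∀ {r} → r ∈ R → r ∈ u
    bumped↑  : ∀ {e} → e ∈ w′ → ∃ λ x → x ∈ u × x <L e
    row≤LIS  : ∀ v → ∃ λ c → c ⊆ u × Row c × All (λ e → toℕ e < v) c × below R v ≤ length c
    LIS≤row  : ∀ s → s ⊆ w′ → Row s → ∀ v → All (λ e → toℕ e < v) s → length s ≤ below R v
    lift     : ∀ s → s ⊆ w′ → Decreasing s → 1 ≤ length s → ∀ y → All (λ e → y ≤ toℕ e) s →
               DecreasingLift u R (length s) y
    equiv    : u ∼ (w′ ++ R)

start : ∀ {q} → Insertion {q} [] [] []
start = record
  { row↑ = []
  ; row⊆ = λ ()
  ; bumped↑ = λ ()
  ; row≤LIS = λ v → [] , [] , [] , [] , z≤n
  ; LIS≤row = λ { .[] [] _ _ _ → z≤n }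
  ; lift = λ { .[] [] _ () }
  ; equiv = ∼-refl }

module InsertStep {q} {u w′ R : Word q} (I : Insertion u w′ R) (x : Fin q) where
  open Insertion I
  u′ R′ : Word q
  u′ = u ++ [ x ]
  R′ = newRow x R

  drop-[] : ∀ {s} → s ⊆ w′ ++ [] → s ⊆ w′
  drop-[] {s} = subst (s ⊆_) (++-identityʳ w′)

  row⊆′ : ∀ {r} → r ∈ R′ → r ∈ u′
  row⊆′ r∈ = [ (λ { refl → ∈-++⁺ʳ u (here refl) }) , ∈-++⁺ˡ ∘ row⊆ ]′ (insert-∈ x R r∈)

  bumped↑′ : ∀ {b} → Bump x R R′ b → ∀ {e} → e ∈ w′ ++ b → ∃ λ x′ → x′ ∈ u′ × x′ <L e
  bumped↑′ b-shape e∈ with ∈-++⁻ w′ e∈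
  ... | inj₁ e∈w′ = let (x′ , x′∈ , x′<e) = bumped↑ e∈w′ in x′ , ∈-++⁺ˡ x′∈ , x′<e
  bumped↑′ (one _ x<y _) _ | inj₂ (here refl) = x , ∈-++⁺ʳ u (here refl) , x<y

  -- If x raises the count below v, then x extends an increasing subsequence below x.
  row≤LIS′ : ∀ v → ∃ λ c → c ⊆ u′ × Row c × All (λ e → toℕ e < v) c × below R′ v ≤ length c
  row≤LIS′ v with below-insert-≤ x R row↑ v
  ... | inj₁ no-gain = let (c , c⊆ , c↑ , c<v , count≤) = row≤LIS v in
    c , ++⁺ʳ [ x ] c⊆ , c↑ , c<v , ≤-trans no-gain count≤
  ... | inj₂ (x<v , gain) = let (c , c⊆ , c↑ , c<x , count≤) = row≤LIS (toℕ x) in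
    c ++ [ x ] , ++⁺ c⊆ ⊆-refl , linked-snoc c↑ c<x , ∷ʳ⁺ (All.map (λ e<x → <-trans e<x x<v) c<x) x<v ,
    ≤-trans gain (≤-trans (s≤s count≤) (≤-reflexive (sym (length-snoc c x))))

  -- An increasing subsequence of w′ ending with the bumped y is at most as
  -- long as the part of the row below y, plus y itself.
  LIS≤row′ : ∀ {b} → Bump x R R′ b → ∀ s → s ⊆ w′ ++ b → Row s → ∀ v → All (λ e → toℕ e < v) s → length s ≤ below R′ v
  LIS≤row′ none s s⊆ s↑ v s<v = ≤-trans (LIS≤row s (drop-[] s⊆) s↑ v s<v) (below-insert-≥ x R v)
  LIS≤row′ (one {y} y∈R _ _) s s⊆ s↑ v s<v with ⊆-snoc-split w′ y s⊆
  ... | inj₁ s⊆w′ = ≤-trans (LIS≤row s s⊆w′ s↑ v s<v) (below-insert-≥ x R v)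
  ... | inj₂ (s₀ , refl , s₀⊆) = begin
    length (s₀ ++ [ y ])  ≡⟨ length-snoc s₀ y ⟩
    suc (length s₀)       ≤⟨ s≤s (LIS≤row s₀ s₀⊆ (linked-init s₀ s↑) (toℕ y) (linked-last <-trans s₀ s↑)) ⟩
    suc (below R (toℕ y)) ≤⟨ below-∈ R y∈R (proj₂ (∷ʳ⁻ s<v)) ⟩
    below R v             ≤⟨ below-insert-≥ x R v ⟩
    below R′ v            ∎
    where open ≤-Reasoning

  -- A decreasing subsequence of w′ ending with the bumped y lifts through the
  -- lift of its part before y, followed by the new end x.
  lift-bumped : ∀ {y} → y ∈ R → x <L y → (∀ {r} → r ∈ R′ → r <L y → toℕ r ≤ toℕ x) →
    ∀ s₀ → s₀ ⊆ w′ → Decreasing (s₀ ++ [ y ]) → ∀ y₀ → All (λ e → y₀ ≤ toℕ e) (s₀ ++ [ y ]) →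
    DecreasingLift u′ R′ (length (s₀ ++ [ y ])) y₀
  lift-bumped {y} y∈R x<y below-y [] _ _ y₀ (y₀≤y ∷ []) = record
    { chain = [ y ] ; end = x
    ; occurs = ++⁺ (from∈ (row⊆ y∈R)) ⊆-refl
    ; decreases = x<y ∷ [-]
    ; size = refl
    ; above = y₀≤y ∷ []
    ; dominates = λ r∈ r<y₀ → below-y r∈ (<-≤-trans r<y₀ y₀≤y) }
  lift-bumped {y} y∈R x<y below-y s₀@(_ ∷ _) s₀⊆ s↓ y₀ s≥y₀
    with ∷ʳ⁻ {xs = s₀} s≥y₀ | lift s₀ s₀⊆ (linked-init s₀ s↓) (s≤s z≤n) (suc (toℕ y)) (linked-last (λ a b → <-trans b a) s₀ s↓)
  ... | _ , y₀≤y | L = record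
    { chain = chain ++ [ end ] ; end = x
    ; occurs = ++⁺ occurs ⊆-refl
    ; decreases = linked-snoc decreases (∷ʳ⁺ (All.map (λ y<e → <-trans x<y y<e) above) (<-≤-trans x<y y≤end))
    ; size = trans (length-snoc chain end) (trans (cong suc size) (sym (length-snoc s₀ y)))
    ; above = ∷ʳ⁺ (All.map (λ y<e → ≤-trans y₀≤y (<⇒≤ y<e)) above) (≤-trans y₀≤y y≤end)
    ; dominates = λ r∈ r<y₀ → below-y r∈ (<-≤-trans r<y₀ y₀≤y) }
    where
    open DecreasingLift L
    y≤end : toℕ y ≤ toℕ end
    y≤end = dominates y∈R (n<1+n (toℕ y))

  lift′ : ∀ {b} → Bump x R R′ b → ∀ s → s ⊆ w′ ++ b → Decreasing s → 1 ≤ length s →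
          ∀ y → All (λ e → y ≤ toℕ e) s → DecreasingLift u′ R′ (length s) y
  lift′ none s s⊆ s↓ s≢[] y s≥y = lift-insert x (lift s (drop-[] s⊆) s↓ s≢[] y s≥y)
  lift′ (one {yb} yb∈R x<yb below-yb) s s⊆ s↓ s≢[] y s≥y with ⊆-snoc-split w′ yb s⊆
  ... | inj₁ s⊆w′ = lift-insert x (lift s s⊆w′ s↓ s≢[] y s≥y)
  ... | inj₂ (s₀ , refl , s₀⊆) = lift-bumped yb∈R x<yb below-yb s₀ s₀⊆ s↓ y s≥y

  equiv′ : ∀ {b} → (R ++ [ x ]) ∼ (b ++ R′) → u′ ∼ ((w′ ++ b) ++ R′)
  equiv′ {b} insert≈ =
    ∼-trans (∼-suffix [ x ] equiv)
    (∼-trans (∼-reflexive (++-assoc w′ R [ x ]))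
    (∼-trans (∼-prefix w′ insert≈) (∼-reflexive (sym (++-assoc w′ b R′)))))

  next : Insertion u′ (w′ ++ bumped x R) R′
  next = record
    { row↑ = insert-row x R row↑
    ; row⊆ = row⊆′
    ; bumped↑ = bumped↑′ (bump x R row↑)
    ; row≤LIS = row≤LIS′
    ; LIS≤row = LIS≤row′ (bump x R row↑)
    ; lift = lift′ (bump x R row↑)
    ; equiv = equiv′ (insert-∼ x R row↑) }

insertStep : ∀ {q} → Word q × Word q → Fin q → Word q × Word q
insertStep (w′ , R) x = w′ ++ bumped x R , newRow x R

rowInsertion : ∀ {q} → Word q → Word q × Word q
rowInsertion = foldl insertStep ([] , [])

insertion-from : ∀ {q} (u : Word q) st rest → Insertion u (proj₁ st) (proj₂ st) →
  Insertion (u ++ rest) (proj₁ (foldl insertStep st rest)) (proj₂ (foldl insertStep st rest))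
insertion-from u st [] I = subst (λ u′ → Insertion u′ (proj₁ st) (proj₂ st)) (sym (++-identityʳ u)) I
insertion-from u st (x ∷ rest) I =
  subst (λ u′ → Insertion u′ _ _) (++-assoc u [ x ] rest)
        (insertion-from (u ++ [ x ]) (insertStep st x) rest (InsertStep.next I x))

insertion : ∀ {q} (w : Word q) → Insertion w (proj₁ (rowInsertion w)) (proj₂ (rowInsertion w))
insertion w = insertion-from [] ([] , []) w start

staircase : ℕ → ℕ → ℕ → ℕ
staircase a m zero = 0
staircase a m (suc b) = a ⊓ m + staircase a (m ∸ 1) b

module Consequences {q} {u w′ R : Word q} (I : Insertion u w′ R) where
  open Insertion I

  LIS-of-row : ∀ {a} → a < length R → LIS> u a
  LIS-of-row {a} a<R with row≤LIS q
  ... | c , c⊆u , c↑ , _ , R≤c = c , c⊆u , c↑ , <-≤-trans a<R (subst (_≤ length c) (below-all R) R≤c)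

  LIS-of-bumped : ∀ {a} → LIS> w′ a → a < length R
  LIS-of-bumped (s , s⊆ , s↑ , a<s) =
    <-≤-trans a<s (≤-trans (LIS≤row s s⊆ s↑ q (All.tabulate (λ {e} _ → toℕ<n e))) (≤-reflexive (below-all R)))

  LDS-of-bumped : ∀ {b} → LDS> w′ b → LDS> u (suc b)
  LDS-of-bumped {b} (s , s⊆ , s↓ , b<s) = chain ++ [ end ] , occurs , decreases ,
    subst (suc b <_) (sym (trans (length-snoc chain end) (cong suc size))) (s≤s b<s)
    where open DecreasingLift (lift s s⊆ s↓ (≤-trans (s≤s z≤n) b<s) 0 (All.tabulate (λ _ → z≤n)))

  inversions-of-insertion : inversions (sortBy toℕ u) ≤ inversions (sortBy toℕ w′) + length R
  inversions-of-insertion = begin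
    inversions (sortBy toℕ u)                ≡⟨ inversions-cong (act equiv toℕ) ⟩
    inversions (sortBy toℕ (w′ ++ R))        ≡⟨ inversions-cong (sortBy-++ toℕ w′ R) ⟩
    inversions (sortBy (sortBy toℕ w′) R)    ≤⟨ inversions-foldl sortStep inversions-sortStep (sortBy toℕ w′) R ⟩
    inversions (sortBy toℕ w′) + length R    ∎
    where open ≤-Reasoning

  -- bumped letters exceed the letters they were bumped by
  bumped-above : ∀ {lo} → (∀ {e} → e ∈ u → lo ≤ toℕ e) → ∀ {e} → e ∈ w′ → suc lo ≤ toℕ e
  bumped-above u≥lo e∈ = let (x , x∈ , x<e) = bumped↑ e∈ in ≤-<-trans (u≥lo x∈) x<e

  row-size : ∀ {lo} → (∀ {e} → e ∈ u → lo ≤ toℕ e) → length R ≤ q ∸ lo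
  row-size {lo} u≥lo = row-length R lo row↑ (All.tabulate (u≥lo ∘ row⊆))

  peel : ∀ {a b lo} → (∀ {e} → e ∈ u → lo ≤ toℕ e) →
    LIS> w′ a ⊎ LDS> w′ b ⊎ inversions (sortBy toℕ w′) ≤ staircase a (q ∸ suc lo) b →
    LIS> u a ⊎ LDS> u (suc b) ⊎ inversions (sortBy toℕ u) ≤ staircase a (q ∸ lo) (suc b)
  peel {a} {b} {lo} u≥lo bumped-bound with a <? length R | bumped-bound
  ... | yes a<R | _ = inj₁ (LIS-of-row a<R)
  ... | no R≯a | inj₁ lis = contradiction (LIS-of-bumped lis) R≯a
  ... | no _ | inj₂ (inj₁ lds) = inj₂ (inj₁ (LDS-of-bumped lds))
  ... | no R≯a | inj₂ (inj₂ few) = inj₂ (inj₂ (begin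
    inversions (sortBy toℕ u)                   ≤⟨ inversions-of-insertion ⟩
    inversions (sortBy toℕ w′) + length R       ≤⟨ +-mono-≤ few (⊓-glb (≮⇒≥ R≯a) (row-size u≥lo)) ⟩
    staircase a (q ∸ suc lo) b + a ⊓ (q ∸ lo)   ≡⟨ cong (λ m → staircase a m b + a ⊓ (q ∸ lo)) one-less ⟨
    staircase a (q ∸ lo ∸ 1) b + a ⊓ (q ∸ lo)   ≡⟨ +-comm _ (a ⊓ (q ∸ lo)) ⟩
    a ⊓ (q ∸ lo) + staircase a (q ∸ lo ∸ 1) b   ∎))
    where
    open ≤-Reasoning
    one-less : q ∸ lo ∸ 1 ≡ q ∸ suc lo
    one-less = trans (∸-+-assoc q lo 1) (cong (q ∸_) (+-comm lo 1))

rows-bound : ∀ {q} a b lo (w : Word q) → (∀ {e} → e ∈ w → lo ≤ toℕ e) →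
             LIS> w a ⊎ LDS> w b ⊎ inversions (sortBy toℕ w) ≤ staircase a (q ∸ lo) b
rows-bound {q} a zero lo [] _ = inj₂ (inj₂ (≤-reflexive (inversions-id {q})))
rows-bound a zero lo (x ∷ w) _ = inj₂ (inj₁ ([ x ] , refl ∷ minimum w , [-] , s≤s z≤n))
rows-bound a (suc b) lo w w≥lo =
  peel w≥lo (rows-bound a b (suc lo) (proj₁ (rowInsertion w)) (bumped-above w≥lo))
  where open Consequences (insertion w)

-- Counting the cells of the staircase by columns instead of rows.
shift-column : ∀ a b m → suc a ⊓ m + b ⊓ (m ∸ suc a) ≡ a ⊓ m + suc b ⊓ (m ∸ a)
shift-column a b zero rewrite ⊓-zeroʳ a | ⊓-zeroʳ b | 0∸n≡0 a = refl
shift-column zero b (suc m) = refl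
shift-column (suc a) b (suc m) = cong suc (shift-column a b m)

staircase-zero : ∀ m b → staircase 0 m b ≡ 0
staircase-zero m zero = refl
staircase-zero m (suc b) = staircase-zero (m ∸ 1) b

staircase-column : ∀ a m b → staircase (suc a) m b ≡ staircase a m b + b ⊓ (m ∸ a)
staircase-column a m zero = refl
staircase-column a m (suc b) = begin
  suc a ⊓ m + staircase (suc a) (m ∸ 1) b                    ≡⟨ cong (suc a ⊓ m +_) (staircase-column a (m ∸ 1) b) ⟩
  suc a ⊓ m + (rest + b ⊓ (m ∸ 1 ∸ a))                       ≡⟨ x∙yz≈y∙xz (suc a ⊓ m) rest _ ⟩
  rest + (suc a ⊓ m + b ⊓ (m ∸ 1 ∸ a))                       ≡⟨ cong (λ k → rest + (suc a ⊓ m + b ⊓ k)) (∸-+-assoc m 1 a) ⟩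
  rest + (suc a ⊓ m + b ⊓ (m ∸ suc a))                       ≡⟨ cong (rest +_) (shift-column a b m) ⟩
  rest + (a ⊓ m + suc b ⊓ (m ∸ a))                           ≡⟨ x∙yz≈yx∙z rest (a ⊓ m) _ ⟩
  (a ⊓ m + rest) + suc b ⊓ (m ∸ a)                           ∎
  where
  open ≡-Reasoning
  rest : ℕ
  rest = staircase a (m ∸ 1) b

bound≡staircase : ∀ q a b → a ≤ q → bound q a b ≡ staircase a q b
bound≡staircase q zero b _ = sym (staircase-zero q b)
bound≡staircase q (suc a) b a<q = begin
  bound q a b + b ⊓ (q ∸ suc a + 1)   ≡⟨ cong₂ _+_ (bound≡staircase q a b (<⇒≤ a<q)) (cong (b ⊓_) column-height) ⟩
  staircase a q b + b ⊓ (q ∸ a)       ≡⟨ staircase-column a q b ⟨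
  staircase (suc a) q b               ∎
  where
  open ≡-Reasoning
  column-height : q ∸ suc a + 1 ≡ q ∸ a
  column-height = trans (+-comm (q ∸ suc a) 1) (sym (+-∸-assoc 1 a<q))

proposition3p2 : (q a b : ℕ) → 1 ≤ a → a < q → 1 ≤ b → b < q →
    (w : Word q) → (π : Perm q) → IsW w π →
    bound q a b < ℓ π → LIS> w a ⊎ LDS> w b
proposition3p2 q a b _ a<q _ _ w π isW bound<ℓ with rows-bound a b 0 w (λ _ → z≤n)
... | inj₁ lis = inj₁ lis
... | inj₂ (inj₁ lds) = inj₂ lds
... | inj₂ (inj₂ few) = contradiction bound<ℓ (≤⇒≯ (begin
    ℓ π                          ≡⟨ ℓ-of-W w π isW ⟩
    inversions (sortBy toℕ w)    ≤⟨ few ⟩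
    staircase a q b              ≡⟨ bound≡staircase q a b (<⇒≤ a<q) ⟨
    bound q a b                  ∎))
  where open ≤-Reasoning
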